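{- Let $m\ge 1$, $b\ge 0$ and $n\ge 1$ be integers, and let $\alpha=\langle a_1,a_2,a_3,\ldots\rangle$ and $\beta=\langle b_1,b_2,b_3,\ldots\rangle$ be states of the multiplex state diagram with $b$ balls and capacity $m$. Let $h=\max\{h(\alpha)-n,\,h(\beta)\}$. Let $\mathcal{A}$ be the $(n+h)\times mn$ $0$-$1$ matrix whose columns are grouped into $n$ consecutive blocks of $m$ columns each, where for every column in the $j$-th block ($1\le j\le n$) the entry in row $i$ ($1\le i\le n+h$) equals $1$ if $i\ge j$ and $0$ if $i<j$. Then the number of walks of length $n$ in the state diagram starting at $\alpha$ and ending at $\beta$ is equal to the number of ways of choosing $mn$ of the entries equal to $1$ in $\mathcal{A}$ such that: (i) exactly one entry is chosen in each column; (ii) the number of chosen entries in the rows are, in order from row $1$ to row $n+h$, \[ m-a_1,\ m-a_2,\ \ldots,\ m-a_n,\ b_1-a_{n+1},\ \ldots,\ b_h-a_{n+h};\] (iii) within each block of $m$ columns, the row indices of the chosen entries are weakly increasing from left to right (i.e., the heights of the chosen $1$'s, with row $1$ drawn at the top, are weakly decreasing from left to right).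
   Context: Fix integers $m\ge 1$ (capacity) and $b\ge 0$ (number of balls). A state is an infinite sequence $\langle a_1,a_2,a_3,\ldots\rangle$ of integers with each $a_i\in\{0,1,\ldots,m\}$ and $\sum_i a_i=b$ (so only finitely many entries are nonzero; $a_i$ is the number of balls scheduled to land at time $i$). The state diagram is the directed graph whose vertices are all states and which has a directed edge $\langle a_1,a_2,\ldots\rangle\to\langle c_1,c_2,\ldots\rangle$ if and only if $a_i\le c_{i-1}$ for all $i\ge 2$. A walk of length $n$ from $\alpha$ to $\beta$ is a sequence of states $\alpha=\sigma_0\to\sigma_1\to\cdots\to\sigma_n=\beta$ with each consecutive pair joined by an edge. The height $h(\alpha)$ of a state $\alpha$ is the largest index $i$ with $a_i>0$. Entries of a state with index beyond its length are $0$. -}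

module Defs where

open import Level using (0ℓ)
open import Data.Nat using (ℕ; zero; suc; _+_; _∸_; _≤_; _<_; _<ᵇ_; _⊔_)
open import Data.Bool using (if_then_else_)
open import Data.List using (List; []; _∷_; _++_; length; filter; map; allFin)
open import Data.Nat.ListAction using (sum)
open import Data.List.Relation.Unary.All using (All)
open import Data.Fin as Fin using (Fin; toℕ; inject₁; fromℕ)
open import Data.Product using (Σ; _×_; proj₁)
open import Relation.Binary.Bundles using (Setoid)
open import Relation.Binary.PropositionalEquality using (_≡_; refl; sym; trans)

-- A state ⟨a₁,a₂,…⟩ (entries in {0..m}, sum b, finite support) is
-- represented canonically by the finite list [a₁,…,a_h] with h the
-- height, i.e. with NO trailing zero (entries beyond the list are 0).
-- This gives a bijection between states and such lists.

NoTrailingZero : List ℕ → Set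
NoTrailingZero l = ∀ (xs : List ℕ) (x : ℕ) → l ≡ xs ++ (x ∷ []) → 0 < x

State : ℕ → ℕ → Set
State m b = Σ (List ℕ) (λ l → All (_≤ m) l × sum l ≡ b × NoTrailingZero l)

-- 0-indexed lookup into the infinite sequence:  l ! k = a_{k+1}
_!_ : List ℕ → ℕ → ℕ
[] ! k = 0
(x ∷ xs) ! zero = x
(x ∷ xs) ! suc k = xs ! k

entry : ∀ {m b} → State m b → ℕ → ℕ
entry α k = proj₁ α ! k

-- height h(α): largest i with a_i > 0 (0 for the empty state);
-- equals the length of the canonical list.
height : ∀ {m b} → State m b → ℕ
height α = length (proj₁ α)

-- Edge α → γ  iff  a_i ≤ c_{i-1} for all i ≥ 2,
-- i.e. a_{k+2} ≤ c_{k+1} for all k ≥ 0.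
Edge : ∀ {m b} → State m b → State m b → Set
Edge α γ = ∀ (k : ℕ) → entry α (suc k) ≤ entry γ k

record Walk (m b n : ℕ) (α β : State m b) : Set where
  field
    σ     : Fin (suc n) → State m b
    start : proj₁ (σ Fin.zero) ≡ proj₁ α
    end   : proj₁ (σ (fromℕ n)) ≡ proj₁ β
    edges : ∀ (k : Fin n) → Edge (σ (inject₁ k)) (σ (Fin.suc k))

WalkSetoid : (m b n : ℕ) → State m b → State m b → Setoid 0ℓ 0ℓ
WalkSetoid m b n α β = record
  { Carrier = Walk m b n α β
  ; _≈_ = λ w w' → ∀ k → proj₁ (Walk.σ w k) ≡ proj₁ (Walk.σ w' k)
  ; isEquivalence = record
    { refl = λ k → refl
    ; sym = λ p k → sym (p k)
    ; trans = λ p q k → trans (p k) (q k) } }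

-- Columns are indexed by (j , p) : Fin n × Fin m  (block j, position p
-- within the block, 0-indexed); rows by Fin (n + h) (0-indexed: row
-- index r corresponds to row r+1 of the paper).  Entry (r ; j , p) of 𝒜
-- is 1 iff  r+1 ≥ j+1, i.e. toℕ j ≤ toℕ r.
-- Condition (i) (exactly one chosen entry per column) is built into the
-- representation: a choice is a function assigning to each column the
-- row of its chosen entry.

rowCount : ∀ {n m k} → (Fin n → Fin m → Fin k) → Fin k → ℕ
rowCount {n} {m} c r =
  sum (map (λ j → length (filter (λ p → c j p Fin.≟ r) (allFin m))) (allFin n))

hh : ∀ {m b} → ℕ → State m b → State m b → ℕ
hh n α β = (height α ∸ n) ⊔ height β

-- the "first term" of the prescribed row count of row r+1:
-- m for rows 1..n, and b_{r+1-n} for rows n+1..n+h.  Condition (ii)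
-- says  rowCount r = rowBase r - a_{r+1}  (an integer equation), which
-- we write as  rowCount r + a_{r+1} ≡ rowBase r  over ℕ.
rowBase : ∀ {m b} → ℕ → State m b → ℕ → ℕ
rowBase {m} n β r = if r <ᵇ n then m else entry β (r ∸ n)

record Choice (m b n : ℕ) (α β : State m b) : Set where
  field
    c      : Fin n → Fin m → Fin (n + hh n α β)
    ones   : ∀ (j : Fin n) (p : Fin m) → toℕ j ≤ toℕ (c j p)
    rows   : ∀ (r : Fin (n + hh n α β)) →
               rowCount c r + entry α (toℕ r) ≡ rowBase n β (toℕ r)
    weakly : ∀ (j : Fin n) (p q : Fin m) → p Fin.≤ q → c j p Fin.≤ c j q

ChoiceSetoid : (m b n : ℕ) → State m b → State m b → Setoid 0ℓ 0ℓ
ChoiceSetoid m b n α β = record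
  { Carrier = Choice m b n α β
  ; _≈_ = λ x y → ∀ j p → Choice.c x j p ≡ Choice.c y j p
  ; isEquivalence = record
    { refl = λ j p → refl
    ; sym = λ e j p → sym (e j p)
    ; trans = λ e f j p → trans (e j p) (f j p) } }

module Submission where

-- A walk α = σ₀ → σ₁ → ⋯ → σₙ = β is encoded block by block: with s = σ_{j−1} and t = σ_j,
-- block j gets m − s₁ chosen entries in row j and t_k − s_{k+1} chosen entries in row j + k.
-- The edge condition makes these counts non-negative, they add up to m because s and t both
-- carry b balls, and summed over the blocks they telescope to the row sums (ii).  Conversely
-- σ_j is recovered from a choice as (σ_j)_k = a_{j+k} + #{chosen entries of blocks 1..j in
-- row j + k}.  By (iii) a block is determined by its row counts, so the two maps are inverse.

open import Data.Bool using (true; false; T)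
open import Data.Fin as Fin using (Fin; toℕ; inject₁; fromℕ; fromℕ<)
open import Data.Fin.Properties
  using (toℕ-injective; toℕ<n; toℕ≤pred[n]; toℕ-fromℕ; toℕ-fromℕ<; toℕ-inject₁)
open import Data.List using (List; []; _∷_; _++_; length; filter; allFin; tabulate; applyUpTo)
open import Data.List.Properties using (map-tabulate; length-applyUpTo)
open import Data.List.Relation.Unary.All using (All; []; _∷_)
open import Data.Nat using (ℕ; zero; suc; _+_; _∸_; _≤_; _<_; _⊓_; z≤n; s≤s; z<s; s<s; _≟_; _<?_; _<ᵇ_)
open import Data.Nat.ListAction using (sum)
open import Data.Nat.Properties
open import Algebra.Properties.CommutativeSemigroup +-commutativeSemigroup
  using (interchange; xy∙z≈xz∙y)
open import Data.Product using (∃; _×_; _,_; proj₁; proj₂)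
open import Data.Sum using ([_,_]′)
open import Data.Unit using (⊤; tt)
open import Function using (id; _∘_)
open import Function.Bundles using (Inverse)
open import Relation.Binary.PropositionalEquality
open import Relation.Nullary using (Dec; yes; no; ¬_; contradiction)
open import Relation.Unary using (Decidable)

open import Defs

-- Finite sums

∑ : ℕ → (ℕ → ℕ) → ℕ
∑ zero    f = 0
∑ (suc K) f = f 0 + ∑ K (f ∘ suc)

∑-cong : ∀ K {f g : ℕ → ℕ} → (∀ k → k < K → f k ≡ g k) → ∑ K f ≡ ∑ K g
∑-cong zero    eq = refl
∑-cong (suc K) eq = cong₂ _+_ (eq 0 z<s) (∑-cong K (λ k k<K → eq (suc k) (s<s k<K)))

∑-zero : ∀ K {f : ℕ → ℕ} → (∀ k → k < K → f k ≡ 0) → ∑ K f ≡ 0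
∑-zero zero    eq = refl
∑-zero (suc K) eq = cong₂ _+_ (eq 0 z<s) (∑-zero K (λ k k<K → eq (suc k) (s<s k<K)))

∑≡0⇒ : ∀ K (f : ℕ → ℕ) → ∑ K f ≡ 0 → ∀ k → k < K → f k ≡ 0
∑≡0⇒ (suc K) f eq zero    _         = m+n≡0⇒m≡0 (f 0) eq
∑≡0⇒ (suc K) f eq (suc k) (s<s k<K) = ∑≡0⇒ K (f ∘ suc) (m+n≡0⇒n≡0 (f 0) eq) k k<K

∑-mono : ∀ K {f g : ℕ → ℕ} → (∀ k → k < K → f k ≤ g k) → ∑ K f ≤ ∑ K g
∑-mono zero    le = z≤n
∑-mono (suc K) le = +-mono-≤ (le 0 z<s) (∑-mono K (λ k k<K → le (suc k) (s<s k<K)))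

∑-distrib-+ : ∀ K (f g : ℕ → ℕ) → ∑ K (λ k → f k + g k) ≡ ∑ K f + ∑ K g
∑-distrib-+ zero    f g = refl
∑-distrib-+ (suc K) f g = trans (cong (f 0 + g 0 +_) (∑-distrib-+ K (f ∘ suc) (g ∘ suc)))
                                (interchange (f 0) (g 0) (∑ K (f ∘ suc)) (∑ K (g ∘ suc)))

∑-split : ∀ A B (f : ℕ → ℕ) → ∑ (A + B) f ≡ ∑ A f + ∑ B (λ k → f (A + k))
∑-split zero    B f = refl
∑-split (suc A) B f = trans (cong (f 0 +_) (∑-split A B (f ∘ suc))) (sym (+-assoc (f 0) _ _))

∑-suc : ∀ K (f : ℕ → ℕ) → ∑ (suc K) f ≡ ∑ K f + f K
∑-suc zero    f = +-comm (f 0) 0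
∑-suc (suc K) f = trans (cong (f 0 +_) (∑-suc K (f ∘ suc))) (sym (+-assoc (f 0) _ _))

∑-swap : ∀ R J (f : ℕ → ℕ → ℕ) → ∑ R (λ r → ∑ J (λ j → f j r)) ≡ ∑ J (λ j → ∑ R (f j))
∑-swap zero    J f = sym (∑-zero J (λ _ _ → refl))
∑-swap (suc R) J f = trans (cong (∑ J (λ j → f j 0) +_) (∑-swap R J (λ j → f j ∘ suc)))
                           (sym (∑-distrib-+ J (λ j → f j 0) (λ j → ∑ R (f j ∘ suc))))

∑-extend : ∀ {A B} (f : ℕ → ℕ) → A ≤ B → (∀ k → A ≤ k → k < B → f k ≡ 0) → ∑ A f ≡ ∑ B f
∑-extend {A} {B} f A≤B zeros = begin
  ∑ A f                                ≡⟨ sym (+-identityʳ _) ⟩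
  ∑ A f + 0                            ≡⟨ cong (∑ A f +_) (sym (∑-zero (B ∸ A) inGap)) ⟩
  ∑ A f + ∑ (B ∸ A) (λ k → f (A + k))  ≡⟨ sym (∑-split A (B ∸ A) f) ⟩
  ∑ (A + (B ∸ A)) f                    ≡⟨ cong (λ x → ∑ x f) (m+[n∸m]≡n A≤B) ⟩
  ∑ B f                                ∎
  where
  open ≡-Reasoning
  inGap : ∀ k → k < B ∸ A → f (A + k) ≡ 0
  inGap k k<B∸A = zeros (A + k) (m≤m+n A k)
    (<-≤-trans (+-monoʳ-< A k<B∸A) (≤-reflexive (m+[n∸m]≡n A≤B)))

∑-monoˡ : ∀ (f : ℕ → ℕ) {A B} → A ≤ B → ∑ A f ≤ ∑ B f
∑-monoˡ f {A} {B} A≤B = begin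
  ∑ A f                                ≤⟨ m≤m+n (∑ A f) _ ⟩
  ∑ A f + ∑ (B ∸ A) (λ k → f (A + k))  ≡⟨ sym (∑-split A (B ∸ A) f) ⟩
  ∑ (A + (B ∸ A)) f                    ≡⟨ cong (λ x → ∑ x f) (m+[n∸m]≡n A≤B) ⟩
  ∑ B f                                ∎
  where open ≤-Reasoning

∑-dropInitialZeros : ∀ j K (f : ℕ → ℕ) → (∀ r → r < j → f r ≡ 0) →
                     ∑ (j + K) f ≡ ∑ K (λ k → f (j + k))
∑-dropInitialZeros j K f zeros = trans (∑-split j K f) (cong (_+ ∑ K (λ k → f (j + k))) (∑-zero j zeros))

-- Counting the values of a sequence

⟦_⟧ : {P : Set} → Dec P → ℕ
⟦ yes _ ⟧ = 1
⟦ no  _ ⟧ = 0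

⟦⟧-yes : {P : Set} (d : Dec P) → P → ⟦ d ⟧ ≡ 1
⟦⟧-yes (yes _) _ = refl
⟦⟧-yes (no ¬p) p = contradiction p ¬p

⟦⟧-no : {P : Set} (d : Dec P) → ¬ P → ⟦ d ⟧ ≡ 0
⟦⟧-no (yes p) ¬p = contradiction p ¬p
⟦⟧-no (no _)  _  = refl

⟦⟧-mono : {P Q : Set} (d : Dec P) (e : Dec Q) → (P → Q) → ⟦ d ⟧ ≤ ⟦ e ⟧
⟦⟧-mono (yes p) e P⇒Q = ≤-reflexive (sym (⟦⟧-yes e (P⇒Q p)))
⟦⟧-mono (no _)  e P⇒Q = z≤n

⟦<?-suc⟧ : ∀ x R → ⟦ x <? suc R ⟧ ≡ ⟦ x <? R ⟧ + ⟦ x ≟ R ⟧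
⟦<?-suc⟧ x R with x <? R | x ≟ R
... | yes x<R | yes refl = contradiction x<R (<-irrefl refl)
... | yes x<R | no  _    = ⟦⟧-yes (x <? suc R) (m<n⇒m<1+n x<R)
... | no  _   | yes refl = ⟦⟧-yes (x <? suc R) ≤-refl
... | no  x≮R | no  x≢R = ⟦⟧-no (x <? suc R) ([ x≮R , x≢R ]′ ∘ m<1+n⇒m<n∨m≡n)

∑-⟦≟⟧ : ∀ R x → ∑ R (λ r → ⟦ x ≟ r ⟧) ≡ ⟦ x <? R ⟧
∑-⟦≟⟧ zero    x = sym (⟦⟧-no (x <? 0) λ ())
∑-⟦≟⟧ (suc R) x = begin
  ∑ (suc R) (λ r → ⟦ x ≟ r ⟧)        ≡⟨ ∑-suc R _ ⟩
  ∑ R (λ r → ⟦ x ≟ r ⟧) + ⟦ x ≟ R ⟧  ≡⟨ cong (_+ ⟦ x ≟ R ⟧) (∑-⟦≟⟧ R x) ⟩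
  ⟦ x <? R ⟧ + ⟦ x ≟ R ⟧             ≡⟨ sym (⟦<?-suc⟧ x R) ⟩
  ⟦ x <? suc R ⟧                     ∎
  where open ≡-Reasoning

∑-⟦<?⟧ : ∀ M c → ∑ M (λ p → ⟦ p <? c ⟧) ≡ M ⊓ c
∑-⟦<?⟧ zero    c = refl
∑-⟦<?⟧ (suc M) c = trans (∑-suc M _) (trans (cong (_+ ⟦ M <? c ⟧) (∑-⟦<?⟧ M c)) (last (M <? c)))
  where
  last : Dec (M < c) → M ⊓ c + ⟦ M <? c ⟧ ≡ suc M ⊓ c
  last (yes M<c) = trans (cong₂ _+_ (m≤n⇒m⊓n≡m (<⇒≤ M<c)) (⟦⟧-yes (M <? c) M<c))
                         (trans (+-comm M 1) (sym (m≤n⇒m⊓n≡m M<c)))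
  last (no M≮c)  = trans (cong₂ _+_ (m≥n⇒m⊓n≡n (≮⇒≥ M≮c)) (⟦⟧-no (M <? c) M≮c))
                         (trans (+-identityʳ c) (sym (m≥n⇒m⊓n≡n (m≤n⇒m≤1+n (≮⇒≥ M≮c)))))

count : ℕ → (ℕ → ℕ) → ℕ → ℕ
count M g r = ∑ M (λ p → ⟦ g p ≟ r ⟧)

countBelow : ℕ → (ℕ → ℕ) → ℕ → ℕ
countBelow M g r = ∑ M (λ p → ⟦ g p <? r ⟧)

countBelow≡∑count : ∀ M g r → countBelow M g r ≡ ∑ r (count M g)
countBelow≡∑count M g r =
  trans (∑-cong M (λ p _ → sym (∑-⟦≟⟧ r (g p)))) (sym (∑-swap r M (λ p r′ → ⟦ g p ≟ r′ ⟧)))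

∑-count : ∀ M g R → (∀ p → p < M → g p < R) → ∑ R (count M g) ≡ M
∑-count M g R g<R = begin
  ∑ R (count M g)          ≡⟨ sym (countBelow≡∑count M g R) ⟩
  countBelow M g R         ≡⟨ ∑-cong M (λ p p<M → trans (⟦⟧-yes _ (g<R p p<M)) (sym (⟦⟧-yes _ p<M))) ⟩
  ∑ M (λ p → ⟦ p <? M ⟧)  ≡⟨ ∑-⟦<?⟧ M M ⟩
  M ⊓ M                    ≡⟨ ⊓-idem M ⟩
  M                        ∎
  where open ≡-Reasoning

count≡0 : ∀ M g r → (∀ p → p < M → g p ≢ r) → count M g r ≡ 0
count≡0 M g r g≢r = ∑-zero M (λ p p<M → ⟦⟧-no (g p ≟ r) (g≢r p p<M))

count≡0⇒ : ∀ M g r → count M g r ≡ 0 → ∀ p → p < M → g p ≢ r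
count≡0⇒ M g r none p p<M gp≡r =
  0≢1+n (trans (sym (∑≡0⇒ M _ none p p<M)) (⟦⟧-yes (g p ≟ r) gp≡r))

WeaklyIncreasing : ℕ → (ℕ → ℕ) → Set
WeaklyIncreasing M g = ∀ p q → p ≤ q → q < M → g p ≤ g q

countBelow-mono : ∀ M g {r r′} → r ≤ r′ → countBelow M g r ≤ countBelow M g r′
countBelow-mono M g r≤r′ = ∑-mono M (λ p _ → ⟦⟧-mono (_ <? _) (_ <? _) (λ gp<r → <-≤-trans gp<r r≤r′))

countBelow-≤ : ∀ M g → WeaklyIncreasing M g → ∀ p → p < M → countBelow M g (g p) ≤ p
countBelow-≤ M g inc p p<M = begin
  countBelow M g (g p)     ≤⟨ ∑-mono M (λ q q<M → ⟦⟧-mono (_ <? _) (_ <? _) (λ gq<gp →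
                                ≰⇒> (λ p≤q → <⇒≱ gq<gp (inc p q p≤q q<M)))) ⟩
  ∑ M (λ q → ⟦ q <? p ⟧)   ≡⟨ ∑-⟦<?⟧ M p ⟩
  M ⊓ p                    ≡⟨ m≥n⇒m⊓n≡n (<⇒≤ p<M) ⟩
  p                        ∎
  where open ≤-Reasoning

<countBelow-suc : ∀ M g → WeaklyIncreasing M g → ∀ p → p < M → p < countBelow M g (suc (g p))
<countBelow-suc M g inc p p<M = begin-strict
  p                             <⟨ n<1+n p ⟩
  suc p                         ≡⟨ sym (m≥n⇒m⊓n≡n p<M) ⟩
  M ⊓ suc p                     ≡⟨ sym (∑-⟦<?⟧ M (suc p)) ⟩
  ∑ M (λ q → ⟦ q <? suc p ⟧)    ≤⟨ ∑-mono M (λ q q<M → ⟦⟧-mono (_ <? _) (_ <? _)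
                                     (λ q<1+p → s≤s (inc q p (m<1+n⇒m≤n q<1+p) p<M))) ⟩
  countBelow M g (suc (g p))    ∎
  where open ≤-Reasoning

sameCounts⇒≮ : ∀ M g g′ → WeaklyIncreasing M g → WeaklyIncreasing M g′ →
               (∀ r → count M g r ≡ count M g′ r) → ∀ p → p < M → ¬ (g p < g′ p)
sameCounts⇒≮ M g g′ inc inc′ same p p<M gp<g′p = <-irrefl refl (begin-strict
  p                          <⟨ <countBelow-suc M g inc p p<M ⟩
  countBelow M g (suc (g p)) ≤⟨ countBelow-mono M g gp<g′p ⟩
  countBelow M g (g′ p)      ≡⟨ countBelow≡∑count M g (g′ p) ⟩
  ∑ (g′ p) (count M g)       ≡⟨ ∑-cong (g′ p) (λ r _ → same r) ⟩
  ∑ (g′ p) (count M g′)      ≡⟨ sym (countBelow≡∑count M g′ (g′ p)) ⟩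
  countBelow M g′ (g′ p)     ≤⟨ countBelow-≤ M g′ inc′ p p<M ⟩
  p                          ∎)
  where open ≤-Reasoning

weaklyIncreasing-unique : ∀ M g g′ → WeaklyIncreasing M g → WeaklyIncreasing M g′ →
                          (∀ r → count M g r ≡ count M g′ r) → ∀ p → p < M → g p ≡ g′ p
weaklyIncreasing-unique M g g′ inc inc′ same p p<M = ≤-antisym
  (≮⇒≥ (sameCounts⇒≮ M g′ g inc′ inc (sym ∘ same) p p<M))
  (≮⇒≥ (sameCounts⇒≮ M g g′ inc inc′ same p p<M))

least : {Q : ℕ → Set} → Decidable Q → ℕ → ℕ
least Q? zero    = 0
least Q? (suc F) with Q? 0
... | yes _ = 0
... | no  _ = suc (least (λ r → Q? (suc r)) F)

least-minimal : ∀ {Q : ℕ → Set} (Q? : Decidable Q) F r → r < least Q? F → ¬ Q r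
least-minimal Q? (suc F) r r<least with Q? 0
least-minimal Q? (suc F) zero    _               | no ¬Q0 = ¬Q0
least-minimal Q? (suc F) (suc r) (s<s r<least)   | no _   = least-minimal (λ r → Q? (suc r)) F r r<least

least-satisfies : ∀ {Q : ℕ → Set} (Q? : Decidable Q) F r → r < F → Q r → Q (least Q? F) × least Q? F < F
least-satisfies Q? (suc F) r r<F Qr with Q? 0
... | yes Q0 = Q0 , z<s
least-satisfies Q? (suc F) zero    _         Q0 | no ¬Q0 = contradiction Q0 ¬Q0
least-satisfies Q? (suc F) (suc r) (s<s r<F) Qr | no _   =
  let Qleast , least<F = least-satisfies (λ r → Q? (suc r)) F r r<F Qr in Qleast , s<s least<F

-- The weakly increasing sequence taking each value r < R exactly d r times: position p
-- holds the least r such that the first r + 1 values account for more than p positions.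
sorted : (ℕ → ℕ) → ℕ → ℕ → ℕ
sorted d R p = least (λ r → p <? ∑ (suc r) d) R

<∑⇒sorted< : ∀ d R p r → p < ∑ r d → sorted d R p < r
<∑⇒sorted< d R p (suc r) p<∑ =
  ≰⇒> (λ r<sorted → least-minimal (λ r → p <? ∑ (suc r) d) R r r<sorted p<∑)

module _ (d : ℕ → ℕ) (R M : ℕ) (total : ∑ R d ≡ M) where

  sorted-spec : ∀ p → p < M → p < ∑ (suc (sorted d R p)) d × sorted d R p < R
  sorted-spec p p<M = go R total
    where
    go : ∀ R → ∑ R d ≡ M → p < ∑ (suc (sorted d R p)) d × sorted d R p < R
    go zero    refl = contradiction p<M λ ()
    go (suc R) sum≡M = least-satisfies (λ r → p <? ∑ (suc r) d) (suc R) R ≤-refl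
                                       (<-≤-trans p<M (≤-reflexive (sym sum≡M)))

  sorted<R : ∀ p → p < M → sorted d R p < R
  sorted<R p p<M = proj₂ (sorted-spec p p<M)

  sorted<⇒<∑ : ∀ p r → p < M → sorted d R p < r → p < ∑ r d
  sorted<⇒<∑ p r p<M sorted<r = <-≤-trans (proj₁ (sorted-spec p p<M)) (∑-monoˡ d sorted<r)

  sorted-weaklyIncreasing : WeaklyIncreasing M (sorted d R)
  sorted-weaklyIncreasing p q p≤q q<M = ≮⇒≥ λ sq<sp →
    <-irrefl refl (<∑⇒sorted< d R p (sorted d R p)
      (≤-<-trans p≤q (sorted<⇒<∑ q (sorted d R p) q<M sq<sp)))

  countBelow-sorted : ∀ r → countBelow M (sorted d R) r ≡ M ⊓ ∑ r d
  countBelow-sorted r = trans (∑-cong M same) (∑-⟦<?⟧ M (∑ r d))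
    where
    same : ∀ p → p < M → ⟦ sorted d R p <? r ⟧ ≡ ⟦ p <? ∑ r d ⟧
    same p p<M with p <? ∑ r d
    ... | yes p<∑ = ⟦⟧-yes (_ <? r) (<∑⇒sorted< d R p r p<∑)
    ... | no  p≮∑ = ⟦⟧-no (_ <? r) (p≮∑ ∘ sorted<⇒<∑ p r p<M)

  count-sorted : ∀ r → r < R → count M (sorted d R) r ≡ d r
  count-sorted r r<R = +-cancelˡ-≡ (∑ r d) _ _ (begin
    ∑ r d + count M (sorted d R) r
      ≡⟨ cong (_+ count M (sorted d R) r) (sym (belowAll r (<⇒≤ r<R))) ⟩
    countBelow M (sorted d R) r + count M (sorted d R) r
      ≡⟨ sym (∑-distrib-+ M _ _) ⟩
    ∑ M (λ p → ⟦ sorted d R p <? r ⟧ + ⟦ sorted d R p ≟ r ⟧)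
      ≡⟨ ∑-cong M (λ p _ → sym (⟦<?-suc⟧ (sorted d R p) r)) ⟩
    countBelow M (sorted d R) (suc r)
      ≡⟨ belowAll (suc r) r<R ⟩
    ∑ (suc r) d
      ≡⟨ ∑-suc r d ⟩
    ∑ r d + d r ∎)
    where
    open ≡-Reasoning
    belowAll : ∀ r → r ≤ R → countBelow M (sorted d R) r ≡ ∑ r d
    belowAll r r≤R = trans (countBelow-sorted r)
                           (m≥n⇒m⊓n≡n (≤-trans (∑-monoˡ d r≤R) (≤-reflexive total)))

  sorted-≥ : ∀ j → (∀ r → r < j → d r ≡ 0) → ∀ p → p < M → j ≤ sorted d R p
  sorted-≥ j zeros p p<M = ≮⇒≥ λ sp<j →
    count≡0⇒ M (sorted d R) (sorted d R p)
      (trans (count-sorted (sorted d R p) (sorted<R p p<M)) (zeros (sorted d R p) sp<j)) p p<M refl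

  sorted-unique : ∀ g → WeaklyIncreasing M g → (∀ p → p < M → g p < R) →
                  (∀ r → r < R → count M g r ≡ d r) → ∀ p → p < M → g p ≡ sorted d R p
  sorted-unique g inc g<R counts =
    weaklyIncreasing-unique M g (sorted d R) inc sorted-weaklyIncreasing sameCounts
    where
    sameCounts : ∀ r → count M g r ≡ count M (sorted d R) r
    sameCounts r with r <? R
    ... | yes r<R = trans (counts r r<R) (sym (count-sorted r r<R))
    ... | no  r≮R = trans (count≡0 M g r (λ p p<M gp≡r → r≮R (subst (_< R) gp≡r (g<R p p<M))))
                          (sym (count≡0 M (sorted d R) r
                                  (λ p p<M sp≡r → r≮R (subst (_< R) sp≡r (sorted<R p p<M)))))

-- States as lists without trailing zeros

!-≥length : ∀ l k → length l ≤ k → l ! k ≡ 0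
!-≥length []       k       _         = refl
!-≥length (x ∷ xs) (suc k) (s≤s le) = !-≥length xs k le

!-applyUpTo : ∀ K f k → k < K → applyUpTo f K ! k ≡ f k
!-applyUpTo (suc K) f zero    _         = refl
!-applyUpTo (suc K) f (suc k) (s<s k<K) = !-applyUpTo K (f ∘ suc) k k<K

!-applyUpTo-≥ : ∀ K f k → K ≤ k → applyUpTo f K ! k ≡ 0
!-applyUpTo-≥ K f k K≤k = !-≥length (applyUpTo f K) k (≤-trans (≤-reflexive (length-applyUpTo f K)) K≤k)

sum≡∑! : ∀ l K → (∀ k → K ≤ k → l ! k ≡ 0) → sum l ≡ ∑ K (l !_)
sum≡∑! []       K       _     = sym (∑-zero K (λ _ _ → refl))
sum≡∑! (x ∷ xs) zero    zeros = cong₂ _+_ (zeros 0 z≤n) (sum≡∑! xs 0 (λ k _ → zeros (suc k) z≤n))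
sum≡∑! (x ∷ xs) (suc K) zeros = cong (x +_) (sum≡∑! xs K (λ k K≤k → zeros (suc k) (s≤s K≤k)))

All≤⇒!≤ : ∀ {m} l → All (_≤ m) l → ∀ k → l ! k ≤ m
All≤⇒!≤ []       _        k       = z≤n
All≤⇒!≤ (x ∷ xs) (x≤ ∷ _) zero    = x≤
All≤⇒!≤ (x ∷ xs) (_ ∷ ≤s) (suc k) = All≤⇒!≤ xs ≤s k

!≤⇒All≤ : ∀ {m} l → (∀ k → l ! k ≤ m) → All (_≤ m) l
!≤⇒All≤ []       _  = []
!≤⇒All≤ (x ∷ xs) ≤m = ≤m 0 ∷ !≤⇒All≤ xs (≤m ∘ suc)

-- A structurally recursive form of NoTrailingZero.
LastPositive : List ℕ → Set
LastPositive []           = ⊤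
LastPositive (x ∷ [])     = 0 < x
LastPositive (x ∷ y ∷ ys) = LastPositive (y ∷ ys)

lastPositive-tail : ∀ x l → LastPositive (x ∷ l) → LastPositive l
lastPositive-tail x []       _   = tt
lastPositive-tail x (y ∷ ys) pos = pos

lastPositive⇒noTrailingZero : ∀ l → LastPositive l → NoTrailingZero l
lastPositive⇒noTrailingZero l pos []       x refl = pos
lastPositive⇒noTrailingZero l pos (y ∷ ys) x refl =
  lastPositive⇒noTrailingZero (ys ++ x ∷ []) (lastPositive-tail y (ys ++ x ∷ []) pos) ys x refl

noTrailingZero⇒lastPositive : ∀ l → NoTrailingZero l → LastPositive l
noTrailingZero⇒lastPositive []           _   = tt
noTrailingZero⇒lastPositive (x ∷ [])     ntz = ntz [] x refl
noTrailingZero⇒lastPositive (x ∷ y ∷ ys) ntz =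
  noTrailingZero⇒lastPositive (y ∷ ys) (λ zs z eq → ntz (x ∷ zs) z (cong (x ∷_) eq))

lastPositive⇒∃-positive : ∀ y ys → LastPositive (y ∷ ys) → ∃ λ k → 0 < (y ∷ ys) ! k
lastPositive⇒∃-positive y []       pos = 0 , pos
lastPositive⇒∃-positive y (z ∷ zs) pos =
  let k , 0<zk = lastPositive⇒∃-positive z zs pos in suc k , 0<zk

lastPositive-!-injective : ∀ l l′ → LastPositive l → LastPositive l′ →
                           (∀ k → l ! k ≡ l′ ! k) → l ≡ l′
lastPositive-!-injective []       []       _   _    _    = refl
lastPositive-!-injective []       (y ∷ ys) _   pos′ same =
  let k , 0<yk = lastPositive⇒∃-positive y ys pos′ in contradiction (sym (same k)) (>⇒≢ 0<yk)
lastPositive-!-injective (x ∷ xs) []       pos _    same =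
  let k , 0<xk = lastPositive⇒∃-positive x xs pos in contradiction (same k) (>⇒≢ 0<xk)
lastPositive-!-injective (x ∷ xs) (y ∷ ys) pos pos′ same =
  cong₂ _∷_ (same 0) (lastPositive-!-injective xs ys (lastPositive-tail x xs pos)
                                                      (lastPositive-tail y ys pos′) (same ∘ suc))

_∷⁺_ : ℕ → List ℕ → List ℕ
zero  ∷⁺ []       = []
zero  ∷⁺ (y ∷ ys) = zero ∷ y ∷ ys
suc x ∷⁺ l        = suc x ∷ l

trim : List ℕ → List ℕ
trim []       = []
trim (x ∷ xs) = x ∷⁺ trim xs

!-∷⁺ : ∀ x l k → (x ∷⁺ l) ! k ≡ (x ∷ l) ! k
!-∷⁺ zero    []       zero    = refl
!-∷⁺ zero    []       (suc k) = refl
!-∷⁺ zero    (y ∷ ys) k       = refl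
!-∷⁺ (suc x) l        k       = refl

!-trim : ∀ l k → trim l ! k ≡ l ! k
!-trim []       k       = refl
!-trim (x ∷ xs) zero    = !-∷⁺ x (trim xs) zero
!-trim (x ∷ xs) (suc k) = trans (!-∷⁺ x (trim xs) (suc k)) (!-trim xs k)

lastPositive-∷⁺ : ∀ x l → LastPositive l → LastPositive (x ∷⁺ l)
lastPositive-∷⁺ zero    []       _   = tt
lastPositive-∷⁺ zero    (y ∷ ys) pos = pos
lastPositive-∷⁺ (suc x) []       _   = z<s
lastPositive-∷⁺ (suc x) (y ∷ ys) pos = pos

lastPositive-trim : ∀ l → LastPositive (trim l)
lastPositive-trim []       = tt
lastPositive-trim (x ∷ xs) = lastPositive-∷⁺ x (trim xs) (lastPositive-trim xs)

entry≤ : ∀ {m b} (σ : State m b) k → entry σ k ≤ m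
entry≤ σ = All≤⇒!≤ (proj₁ σ) (proj₁ (proj₂ σ))

entry-≥height : ∀ {m b} (σ : State m b) k → height σ ≤ k → entry σ k ≡ 0
entry-≥height σ = !-≥length (proj₁ σ)

∑-entry : ∀ {m b} (σ : State m b) K → (∀ k → K ≤ k → entry σ k ≡ 0) → ∑ K (entry σ) ≡ b
∑-entry σ K zeros = trans (sym (sum≡∑! (proj₁ σ) K zeros)) (proj₁ (proj₂ (proj₂ σ)))

state-ext : ∀ {m b} (σ τ : State m b) → (∀ k → entry σ k ≡ entry τ k) → proj₁ σ ≡ proj₁ τ
state-ext (l , _ , _ , ntz) (l′ , _ , _ , ntz′) =
  lastPositive-!-injective l l′ (noTrailingZero⇒lastPositive l ntz) (noTrailingZero⇒lastPositive l′ ntz′)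

module StateFrom {m b : ℕ} (N : ℕ) (f : ℕ → ℕ) (f≤m : ∀ k → f k ≤ m)
                 (zeros : ∀ k → N ≤ k → f k ≡ 0) (∑f : ∑ N f ≡ b) where

  private
    list : List ℕ
    list = trim (applyUpTo f N)

    !-list : ∀ k → list ! k ≡ f k
    !-list k with k <? N
    ... | yes k<N = trans (!-trim (applyUpTo f N) k) (!-applyUpTo N f k k<N)
    ... | no  k≮N = trans (!-trim (applyUpTo f N) k)
                          (trans (!-applyUpTo-≥ N f k (≮⇒≥ k≮N)) (sym (zeros k (≮⇒≥ k≮N))))

  state : State m b
  state = list
    , !≤⇒All≤ list (λ k → subst (_≤ m) (sym (!-list k)) (f≤m k))
    , trans (sum≡∑! list N (λ k N≤k → trans (!-list k) (zeros k N≤k)))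
            (trans (∑-cong N (λ k _ → !-list k)) ∑f)
    , lastPositive⇒noTrailingZero list (lastPositive-trim (applyUpTo f N))

  entry-state : ∀ k → entry state k ≡ f k
  entry-state = !-list

extend : ∀ {A : Set} {k} → (Fin k → A) → A → ℕ → A
extend {k = zero}  F d i       = d
extend {k = suc k} F d zero    = F Fin.zero
extend {k = suc k} F d (suc i) = extend (F ∘ Fin.suc) d i

extend-toℕ : ∀ {A : Set} {k} (F : Fin k → A) d (x : Fin k) → extend F d (toℕ x) ≡ F x
extend-toℕ F d Fin.zero    = refl
extend-toℕ F d (Fin.suc x) = extend-toℕ (F ∘ Fin.suc) d x

extend-< : ∀ {A : Set} {k} (F : Fin k → A) d {i} (i<k : i < k) → extend F d i ≡ F (fromℕ< i<k)
extend-< F d i<k = trans (cong (extend F d) (sym (toℕ-fromℕ< i<k))) (extend-toℕ F d (fromℕ< i<k))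

extend-cong : ∀ {A : Set} {k} {F F′ : Fin k → A} d → (∀ x → F x ≡ F′ x) →
              ∀ i → extend F d i ≡ extend F′ d i
extend-cong {k = zero}  d eq i       = refl
extend-cong {k = suc k} d eq zero    = eq Fin.zero
extend-cong {k = suc k} d eq (suc i) = extend-cong d (eq ∘ Fin.suc) i

sum-tabulate : ∀ {k} (F : Fin k → ℕ) → sum (tabulate F) ≡ ∑ k (extend F 0)
sum-tabulate {zero}  F = refl
sum-tabulate {suc k} F = cong (F Fin.zero +_) (sum-tabulate (F ∘ Fin.suc))

length-filter-tabulate : ∀ {A : Set} {P : A → Set} (P? : Decidable P) {k} (h : Fin k → A) →
                         length (filter P? (tabulate h)) ≡ ∑ k (extend (λ i → ⟦ P? (h i) ⟧) 0)
length-filter-tabulate P? {zero}  h = refl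
length-filter-tabulate P? {suc k} h with P? (h Fin.zero)
... | yes _ = cong suc (length-filter-tabulate P? (h ∘ Fin.suc))
... | no  _ = length-filter-tabulate P? (h ∘ Fin.suc)

⟦≟⟧-toℕ : ∀ {N} (x r : Fin N) → ⟦ x Fin.≟ r ⟧ ≡ ⟦ toℕ x ≟ toℕ r ⟧
⟦≟⟧-toℕ x r with x Fin.≟ r
... | yes x≡r = sym (⟦⟧-yes (toℕ x ≟ toℕ r) (cong toℕ x≡r))
... | no  x≢r = sym (⟦⟧-no (toℕ x ≟ toℕ r) (x≢r ∘ toℕ-injective))

-- A choice c read as a function of natural-number indices: the row chosen in column p of
-- block j (junk value 0 outside the matrix).
chosenRow : ∀ {n m N} → (Fin n → Fin m → Fin N) → ℕ → ℕ → ℕ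
chosenRow c j p = extend (λ x → extend (λ y → toℕ (c x y)) 0 p) 0 j

chosenRow-toℕ : ∀ {n m N} (c : Fin n → Fin m → Fin N) x y → chosenRow c (toℕ x) (toℕ y) ≡ toℕ (c x y)
chosenRow-toℕ c x y = trans (extend-toℕ _ 0 x) (extend-toℕ _ 0 y)

chosenRow-< : ∀ {n m N} (c : Fin n → Fin m → Fin N) {j p} (j<n : j < n) (p<m : p < m) →
              chosenRow c j p ≡ toℕ (c (fromℕ< j<n) (fromℕ< p<m))
chosenRow-< c j<n p<m = trans (extend-< _ 0 j<n) (extend-< _ 0 p<m)

chosenRow-cong : ∀ {n m N} {c c′ : Fin n → Fin m → Fin N} → (∀ x y → c x y ≡ c′ x y) →
                 ∀ j p → chosenRow c j p ≡ chosenRow c′ j p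
chosenRow-cong eq j p = extend-cong 0 (λ x → extend-cong 0 (λ y → cong toℕ (eq x y)) p) j

rowCount≡∑count : ∀ {n m N} (c : Fin n → Fin m → Fin N) (r : Fin N) →
                  rowCount c r ≡ ∑ n (λ j → count m (chosenRow c j) (toℕ r))
rowCount≡∑count {n} {m} c r = begin
  rowCount c r               ≡⟨ cong sum (map-tabulate id inBlock) ⟩
  sum (tabulate inBlock)     ≡⟨ sum-tabulate inBlock ⟩
  ∑ n (extend inBlock 0)     ≡⟨ ∑-cong n (λ j j<n → trans (extend-< inBlock 0 j<n) (inBlock≡count j<n)) ⟩
  ∑ n (λ j → count m (chosenRow c j) (toℕ r)) ∎
  where
  open ≡-Reasoning
  inBlock : Fin n → ℕ
  inBlock x = length (filter (λ p → c x p Fin.≟ r) (allFin m))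
  inBlock≡count : ∀ {j} (j<n : j < n) → inBlock (fromℕ< j<n) ≡ count m (chosenRow c j) (toℕ r)
  inBlock≡count {j} j<n = trans (length-filter-tabulate (λ p → c (fromℕ< j<n) p Fin.≟ r) id)
    (∑-cong m λ p p<m → begin
      extend (λ y → ⟦ c (fromℕ< j<n) y Fin.≟ r ⟧) 0 p   ≡⟨ extend-< _ 0 p<m ⟩
      ⟦ c (fromℕ< j<n) (fromℕ< p<m) Fin.≟ r ⟧           ≡⟨ ⟦≟⟧-toℕ _ r ⟩
      ⟦ toℕ (c (fromℕ< j<n) (fromℕ< p<m)) ≟ toℕ r ⟧      ≡⟨ cong (λ v → ⟦ v ≟ toℕ r ⟧) (sym (chosenRow-< c j<n p<m)) ⟩
      ⟦ chosenRow c j p ≟ toℕ r ⟧                        ∎)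

-- Walks versus choices

shift : ℕ → (ℕ → ℕ) → ℕ → ℕ
shift zero    f r       = f r
shift (suc j) f zero    = 0
shift (suc j) f (suc r) = shift j f r

shift-< : ∀ j f r → r < j → shift j f r ≡ 0
shift-< (suc j) f zero    _         = refl
shift-< (suc j) f (suc r) (s<s r<j) = shift-< j f r r<j

shift-+ : ∀ j f k → shift j f (j + k) ≡ f k
shift-+ zero    f k = refl
shift-+ (suc j) f k = shift-+ j f k

shift-cong : ∀ j {f f′ : ℕ → ℕ} → (∀ k → f k ≡ f′ k) → ∀ r → shift j f r ≡ shift j f′ r
shift-cong zero    eq r       = eq r
shift-cong (suc j) eq zero    = refl
shift-cong (suc j) eq (suc r) = shift-cong j eq r

shift-unique : ∀ j (f g : ℕ → ℕ) → (∀ r → r < j → f r ≡ 0) → (∀ k → f (j + k) ≡ g k) →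
               ∀ r → f r ≡ shift j g r
shift-unique zero    f g _     eq r       = eq r
shift-unique (suc j) f g zeros eq zero    = zeros 0 z<s
shift-unique (suc j) f g zeros eq (suc r) = shift-unique j (f ∘ suc) g (λ r r<j → zeros (suc r) (s<s r<j)) eq r

module Correspondence (m b n : ℕ) (α β : State m b) where

  H N : ℕ
  H = hh n α β
  N = n + H

  a : ℕ → ℕ
  a = entry α

  n≤N : n ≤ N
  n≤N = m≤m+n n H

  a-≥N : ∀ k → N ≤ k → a k ≡ 0
  a-≥N k N≤k = entry-≥height α k (begin
    height α                 ≤⟨ m≤n+m∸n (height α) n ⟩
    n + (height α ∸ n)       ≤⟨ +-monoʳ-≤ n (m≤m⊔n (height α ∸ n) (height β)) ⟩
    N                        ≤⟨ N≤k ⟩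
    k                        ∎)
    where open ≤-Reasoning

  β-≥H : ∀ k → H ≤ k → entry β k ≡ 0
  β-≥H k H≤k = entry-≥height β k (≤-trans (m≤n⊔m (height α ∸ n) (height β)) H≤k)

  rowBase≤m : ∀ r → rowBase n β r ≤ m
  rowBase≤m r with r <ᵇ n
  ... | true  = ≤-refl
  ... | false = entry≤ β (r ∸ n)

  rowBase-< : ∀ r → r < n → rowBase n β r ≡ m
  rowBase-< r r<n with r <ᵇ n | <⇒<ᵇ r<n
  ... | true | _ = refl

  rowBase-+ : ∀ k → rowBase n β (n + k) ≡ entry β k
  rowBase-+ k with n + k <ᵇ n in eq
  ... | true  = contradiction (m≤m+n n k) (<⇒≱ (<ᵇ⇒< (n + k) n (subst T (sym eq) tt)))
  ... | false = cong (entry β) (m+n∸m≡n n k)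

  module FromChoice (ch : Choice m b n α β) where
    open Choice ch

    G : ℕ → ℕ → ℕ
    G = chosenRow c

    D : ℕ → ℕ → ℕ
    D j = count m (G j)

    P : ℕ → ℕ → ℕ
    P j r = ∑ j (λ i → D i r)

    -- The balls landing at time j + k in the j-th state: those scheduled in α, plus those
    -- the first j blocks send to row j + k.
    s : ℕ → ℕ → ℕ
    s j k = a (j + k) + P j (j + k)

    G<N : ∀ {j p} → j < n → p < m → G j p < N
    G<N j<n p<m = subst (_< N) (sym (chosenRow-< c j<n p<m)) (toℕ<n _)

    j≤G : ∀ {j p} → j < n → p < m → j ≤ G j p
    j≤G {j} {p} j<n p<m = subst₂ _≤_ (toℕ-fromℕ< j<n) (sym (chosenRow-< c j<n p<m))
                                  (ones (fromℕ< j<n) (fromℕ< p<m))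

    D-≥N : ∀ j r → j < n → N ≤ r → D j r ≡ 0
    D-≥N j r j<n N≤r = count≡0 m (G j) r λ p p<m G≡r →
      <⇒≱ (G<N j<n p<m) (≤-trans N≤r (≤-reflexive (sym G≡r)))

    D-< : ∀ j r → j < n → r < j → D j r ≡ 0
    D-< j r j<n r<j = count≡0 m (G j) r λ p p<m G≡r →
      <⇒≱ r<j (≤-trans (j≤G j<n p<m) (≤-reflexive G≡r))

    ∑D : ∀ j R → j < n → N ≤ R → ∑ R (D j) ≡ m
    ∑D j R j<n N≤R = ∑-count m (G j) R (λ p p<m → <-≤-trans (G<N j<n p<m) N≤R)

    P-≥N : ∀ j r → j ≤ n → N ≤ r → P j r ≡ 0
    P-≥N j r j≤n N≤r = ∑-zero j (λ i i<j → D-≥N i r (<-≤-trans i<j j≤n) N≤r)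

    P-extend : ∀ t r → t ≤ n → r < t → P t r ≡ P n r
    P-extend t r t≤n r<t = ∑-extend (λ i → D i r) t≤n (λ i t≤i i<n → D-< i r i<n (<-≤-trans r<t t≤i))

    P+a≡rowBase : ∀ r → r < N → P n r + a r ≡ rowBase n β r
    P+a≡rowBase r r<N = subst (λ v → P n v + a v ≡ rowBase n β v) (toℕ-fromℕ< r<N)
      (trans (cong (_+ a (toℕ (fromℕ< r<N))) (sym (rowCount≡∑count c (fromℕ< r<N)))) (rows (fromℕ< r<N)))

    P+a≤m : ∀ r → P n r + a r ≤ m
    P+a≤m r with r <? N
    ... | yes r<N = ≤-trans (≤-reflexive (P+a≡rowBase r r<N)) (rowBase≤m r)
    ... | no  r≮N = subst (_≤ m) (sym (cong₂ _+_ (P-≥N n r ≤-refl (≮⇒≥ r≮N)) (a-≥N r (≮⇒≥ r≮N)))) z≤n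

    s-suc : ∀ j k → s (suc j) k ≡ s j (suc k) + D j (j + suc k)
    s-suc j k = begin
      a (suc (j + k)) + ∑ (suc j) (λ i → D i (suc (j + k)))
        ≡⟨ cong (a (suc (j + k)) +_) (∑-suc j _) ⟩
      a (suc (j + k)) + (P j (suc (j + k)) + D j (suc (j + k)))
        ≡⟨ sym (+-assoc (a (suc (j + k))) _ _) ⟩
      a (suc (j + k)) + P j (suc (j + k)) + D j (suc (j + k))
        ≡⟨ cong (λ r → a r + P j r + D j r) (sym (+-suc j k)) ⟩
      s j (suc k) + D j (j + suc k) ∎
      where open ≡-Reasoning

    s-edge : ∀ j k → s j (suc k) ≤ s (suc j) k
    s-edge j k = ≤-trans (m≤m+n _ _) (≤-reflexive (sym (s-suc j k)))

    s-≥N : ∀ j k → j ≤ n → N ≤ j + k → s j k ≡ 0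
    s-≥N j k j≤n N≤j+k = cong₂ _+_ (a-≥N (j + k) N≤j+k) (P-≥N j (j + k) j≤n N≤j+k)

    s≤m : ∀ j k → j ≤ n → s j k ≤ m
    s≤m j k j≤n = begin
      a (j + k) + P j (j + k)   ≤⟨ +-monoʳ-≤ (a (j + k)) (∑-monoˡ (λ i → D i (j + k)) j≤n) ⟩
      a (j + k) + P n (j + k)   ≡⟨ +-comm (a (j + k)) _ ⟩
      P n (j + k) + a (j + k)   ≤⟨ P+a≤m (j + k) ⟩
      m                         ∎
      where open ≤-Reasoning

    s-0 : ∀ k → s 0 k ≡ a k
    s-0 k = +-identityʳ (a k)

    s-n : ∀ k → s n k ≡ entry β k
    s-n k with n + k <? N
    ... | yes n+k<N = trans (+-comm (a (n + k)) _) (trans (P+a≡rowBase (n + k) n+k<N) (rowBase-+ k))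
    ... | no  n+k≮N = trans (s-≥N n k ≤-refl (≮⇒≥ n+k≮N))
                            (sym (β-≥H k (+-cancelˡ-≤ n H k (≮⇒≥ n+k≮N))))

    s+D≡m : ∀ j → j < n → s j 0 + D j (j + 0) ≡ m
    s+D≡m j j<n = begin
      a r + P j r + D j r     ≡⟨ +-assoc (a r) _ _ ⟩
      a r + (P j r + D j r)   ≡⟨ cong (a r +_) (sym (∑-suc j (λ i → D i r))) ⟩
      a r + P (suc j) r       ≡⟨ cong (a r +_) (P-extend (suc j) r j<n (s≤s (≤-reflexive (+-identityʳ j)))) ⟩
      a r + P n r             ≡⟨ +-comm (a r) _ ⟩
      P n r + a r             ≡⟨ P+a≡rowBase r (<-≤-trans r<n n≤N) ⟩
      rowBase n β r           ≡⟨ rowBase-< r r<n ⟩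
      m                       ∎
      where
      open ≡-Reasoning
      r = j + 0
      r<n : r < n
      r<n = subst (_< n) (sym (+-identityʳ j)) j<n

    ∑s : ∀ j → j ≤ n → ∑ N (s j) ≡ b
    ∑s zero    _     = trans (∑-cong N (λ k _ → s-0 k)) (∑-entry α N a-≥N)
    ∑s (suc j) 1+j≤n = +-cancelʳ-≡ m _ b (begin
      ∑ N (s (suc j)) + m    ≡⟨ cong₂ _+_ split (sym (s+D≡m j 1+j≤n)) ⟩
      (Y + Z) + (s0 + d0)    ≡⟨ interchange Y Z s0 d0 ⟩
      (Y + s0) + (Z + d0)    ≡⟨ cong₂ _+_ (+-comm Y s0) (+-comm Z d0) ⟩
      (s0 + Y) + (d0 + Z)    ≡⟨ cong₂ _+_ remaining thrown ⟩
      b + m                  ∎)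
      where
      open ≡-Reasoning
      Y = ∑ N (s j ∘ suc)
      Z = ∑ N (λ k → D j (j + suc k))
      s0 = s j 0
      d0 = D j (j + 0)
      split : ∑ N (s (suc j)) ≡ Y + Z
      split = trans (∑-cong N (λ k _ → s-suc j k)) (∑-distrib-+ N _ _)
      remaining : s0 + Y ≡ b
      remaining = trans (∑-suc N (s j))
        (trans (cong₂ _+_ (∑s j (<⇒≤ 1+j≤n)) (s-≥N j N (<⇒≤ 1+j≤n) (m≤n+m N j))) (+-identityʳ b))
      thrown : d0 + Z ≡ m
      thrown = trans (sym (∑-dropInitialZeros j (suc N) (D j) (λ r r<j → D-< j r 1+j≤n r<j)))
                     (∑D j (j + suc N) 1+j≤n (≤-trans (n≤1+n N) (m≤n+m (suc N) j)))

    module _ (i : Fin (suc n)) where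
      open StateFrom {m} {b} N (s (toℕ i)) (λ k → s≤m (toℕ i) k (toℕ≤pred[n] i))
        (λ k N≤k → s-≥N (toℕ i) k (toℕ≤pred[n] i) (≤-trans N≤k (m≤n+m k (toℕ i))))
        (∑s (toℕ i) (toℕ≤pred[n] i)) public

    walk : Walk m b n α β
    walk = record
      { σ     = state
      ; start = state-ext (state Fin.zero) α (λ k → trans (entry-state Fin.zero k) (s-0 k))
      ; end   = state-ext (state (fromℕ n)) β λ k →
                  trans (entry-state (fromℕ n) k) (trans (cong (λ j → s j k) (toℕ-fromℕ n)) (s-n k))
      ; edges = λ x k → subst₂ _≤_
                  (sym (trans (entry-state (inject₁ x) (suc k)) (cong (λ j → s j (suc k)) (toℕ-inject₁ x))))
                  (sym (entry-state (Fin.suc x) k))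
                  (s-edge (toℕ x) k)
      }

  -- The row counts of block j relative to row j, read off from the step s → t of the walk:
  -- m − s₀ entries in row j and t_k − s_{k+1} entries in row j + k + 1.
  gaps : (ℕ → ℕ) → (ℕ → ℕ) → ℕ → ℕ
  gaps s t zero    = m ∸ s 0
  gaps s t (suc k) = t k ∸ s (suc k)

  gaps-cong : ∀ {s s′ t t′ : ℕ → ℕ} → (∀ k → s k ≡ s′ k) → (∀ k → t k ≡ t′ k) →
              ∀ k → gaps s t k ≡ gaps s′ t′ k
  gaps-cong eqs eqt zero    = cong (m ∸_) (eqs 0)
  gaps-cong eqs eqt (suc k) = cong₂ _∸_ (eqt k) (eqs (suc k))

  module FromWalk (w : Walk m b n α β) where
    open Walk w

    s : ℕ → ℕ → ℕ
    s j k = extend (λ i → entry (σ i) k) 0 j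

    s-toℕ : ∀ i k → s (toℕ i) k ≡ entry (σ i) k
    s-toℕ i k = extend-toℕ (λ i → entry (σ i) k) 0 i

    s-≤n : ∀ j k (j≤n : j ≤ n) → s j k ≡ entry (σ (fromℕ< (s≤s j≤n))) k
    s-≤n j k j≤n = extend-< (λ i → entry (σ i) k) 0 (s≤s j≤n)

    s-0 : ∀ k → s 0 k ≡ a k
    s-0 k = cong (_! k) start

    s-n : ∀ k → s n k ≡ entry β k
    s-n k = trans (cong (λ j → s j k) (sym (toℕ-fromℕ n))) (trans (s-toℕ (fromℕ n) k) (cong (_! k) end))

    s-edge : ∀ j k → j < n → s j (suc k) ≤ s (suc j) k
    s-edge j k j<n = subst₂ _≤_
      (trans (sym (s-toℕ (inject₁ x) (suc k)))
             (cong (λ v → s v (suc k)) (trans (toℕ-inject₁ x) (toℕ-fromℕ< j<n))))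
      (trans (sym (s-toℕ (Fin.suc x) k)) (cong (λ v → s (suc v) k) (toℕ-fromℕ< j<n)))
      (edges x k)
      where x = fromℕ< j<n

    s≤m : ∀ j k → j ≤ n → s j k ≤ m
    s≤m j k j≤n = subst (_≤ m) (sym (s-≤n j k j≤n)) (entry≤ (σ (fromℕ< (s≤s j≤n))) k)

    s-chain : ∀ t j k → j + t ≤ n → s j (t + k) ≤ s (j + t) k
    s-chain zero    j k _       = ≤-reflexive (cong (λ v → s v k) (sym (+-identityʳ j)))
    s-chain (suc t) j k j+t<n = begin
      s j (suc (t + k))     ≤⟨ s-edge j (t + k) (<-≤-trans (m<m+n j z<s) j+t<n) ⟩
      s (suc j) (t + k)     ≤⟨ s-chain t (suc j) k (≤-trans (≤-reflexive (sym (+-suc j t))) j+t<n) ⟩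
      s (suc j + t) k       ≡⟨ cong (λ v → s v k) (sym (+-suc j t)) ⟩
      s (j + suc t) k       ∎
      where open ≤-Reasoning

    -- Along the walk entries only move forward, so entry k of σ_j is at most entry
    -- k − (n − j) of β, which vanishes once j + k ≥ N.
    s-≥N : ∀ j k → j ≤ n → N ≤ j + k → s j k ≡ 0
    s-≥N j k j≤n N≤j+k = n≤0⇒n≡0 (begin
      s j k                ≡⟨ cong (s j) (sym t+k′≡k) ⟩
      s j (t + k′)         ≤⟨ s-chain t j k′ (≤-reflexive j+t≡n) ⟩
      s (j + t) k′         ≡⟨ cong (λ v → s v k′) j+t≡n ⟩
      s n k′               ≡⟨ s-n k′ ⟩
      entry β k′           ≡⟨ β-≥H k′ H≤k′ ⟩
      0                    ∎)
      where
      open ≤-Reasoning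
      t = n ∸ j
      k′ = k ∸ t
      j+t≡n : j + t ≡ n
      j+t≡n = m+[n∸m]≡n j≤n
      t+k′≡k : t + k′ ≡ k
      t+k′≡k = m+[n∸m]≡n (≤-trans (∸-monoˡ-≤ j (≤-trans n≤N N≤j+k)) (≤-reflexive (m+n∸m≡n j k)))
      H≤k′ : H ≤ k′
      H≤k′ = +-cancelˡ-≤ n H k′ (≤-trans N≤j+k (≤-reflexive (begin-equality
        j + k           ≡⟨ cong (j +_) (sym t+k′≡k) ⟩
        j + (t + k′)    ≡⟨ sym (+-assoc j t k′) ⟩
        j + t + k′      ≡⟨ cong (_+ k′) j+t≡n ⟩
        n + k′          ∎)))

    ∑s : ∀ j → j ≤ n → ∑ N (s j) ≡ b
    ∑s j j≤n = trans (∑-cong N (λ k _ → s-≤n j k j≤n))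
      (∑-entry (σ (fromℕ< (s≤s j≤n))) N λ k N≤k →
         trans (sym (s-≤n j k j≤n)) (s-≥N j k j≤n (≤-trans N≤k (m≤n+m k j))))

    D : ℕ → ℕ → ℕ
    D j = shift j (gaps (s j) (s (suc j)))

    gaps-≥N : ∀ j k → j < n → N ≤ j + k → gaps (s j) (s (suc j)) k ≡ 0
    gaps-≥N j zero    j<n N≤j+0 = contradiction (≤-trans N≤j+0 (≤-reflexive (+-identityʳ j)))
                                                (<⇒≱ (<-≤-trans j<n n≤N))
    gaps-≥N j (suc k) j<n N≤j+1+k = trans
      (cong (_∸ s j (suc k)) (s-≥N (suc j) k j<n (≤-trans N≤j+1+k (≤-reflexive (+-suc j k)))))
      (0∸n≡0 (s j (suc k)))

    D-≥N : ∀ j r → j < n → N ≤ r → D j r ≡ 0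
    D-≥N j r j<n N≤r = begin
      D j r                                ≡⟨ cong (D j) (sym (m+[n∸m]≡n j≤r)) ⟩
      D j (j + (r ∸ j))                    ≡⟨ shift-+ j _ (r ∸ j) ⟩
      gaps (s j) (s (suc j)) (r ∸ j)       ≡⟨ gaps-≥N j (r ∸ j) j<n (≤-trans N≤r (≤-reflexive (sym (m+[n∸m]≡n j≤r)))) ⟩
      0                                    ∎
      where
      open ≡-Reasoning
      j≤r = ≤-trans (<⇒≤ j<n) (≤-trans n≤N N≤r)

    ∑D : ∀ j → j < n → ∑ N (D j) ≡ m
    ∑D j j<n = begin
      ∑ N (D j)                             ≡⟨ ∑-extend (D j) N≤j+1+N (λ r N≤r _ → D-≥N j r j<n N≤r) ⟩
      ∑ (j + suc N) (D j)                   ≡⟨ ∑-dropInitialZeros j (suc N) (D j) (λ r r<j → shift-< j _ r r<j) ⟩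
      ∑ (suc N) (λ k → D j (j + k))         ≡⟨ ∑-cong (suc N) (λ k _ → shift-+ j (gaps (s j) (s (suc j))) k) ⟩
      (m ∸ s0) + X                          ≡⟨ cong ((m ∸ s0) +_) X≡s0 ⟩
      (m ∸ s0) + s0                         ≡⟨ m∸n+n≡m (s≤m j 0 (<⇒≤ j<n)) ⟩
      m                                     ∎
      where
      open ≡-Reasoning
      N≤j+1+N = ≤-trans (n≤1+n N) (m≤n+m (suc N) j)
      s0 = s j 0
      X = ∑ N (λ k → s (suc j) k ∸ s j (suc k))
      Y = ∑ N (s j ∘ suc)
      X+Y≡b : X + Y ≡ b
      X+Y≡b = trans (sym (∑-distrib-+ N _ _))
                    (trans (∑-cong N (λ k _ → m∸n+n≡m (s-edge j k j<n))) (∑s (suc j) j<n))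
      s0+Y≡b : s0 + Y ≡ b
      s0+Y≡b = trans (∑-suc N (s j))
        (trans (cong₂ _+_ (∑s j (<⇒≤ j<n)) (s-≥N j N (<⇒≤ j<n) (m≤n+m N j))) (+-identityʳ b))
      X≡s0 : X ≡ s0
      X≡s0 = +-cancelʳ-≡ Y X s0 (trans X+Y≡b (sym s0+Y≡b))

    partialSums : ∀ t k → t ≤ n → ∑ t (λ j → D j (t + k)) + a (t + k) ≡ s t k
    partialSums zero    k _     = sym (s-0 k)
    partialSums (suc t) k 1+t≤n = begin
      ∑ (suc t) (λ j → D j (suc t + k)) + a (suc t + k)
        ≡⟨ cong (λ r → ∑ (suc t) (λ j → D j r) + a r) (sym (+-suc t k)) ⟩
      ∑ (suc t) (λ j → D j r) + a r
        ≡⟨ cong (_+ a r) (∑-suc t _) ⟩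
      ∑ t (λ j → D j r) + D t r + a r
        ≡⟨ xy∙z≈xz∙y (∑ t (λ j → D j r)) (D t r) (a r) ⟩
      ∑ t (λ j → D j r) + a r + D t r
        ≡⟨ cong₂ _+_ (partialSums t (suc k) (<⇒≤ 1+t≤n)) (shift-+ t _ (suc k)) ⟩
      s t (suc k) + (s (suc t) k ∸ s t (suc k))
        ≡⟨ m+[n∸m]≡n (s-edge t k 1+t≤n) ⟩
      s (suc t) k ∎
      where
      open ≡-Reasoning
      r = t + suc k

    RowCondition : ℕ → Set
    RowCondition r = ∑ n (λ j → D j r) + a r ≡ rowBase n β r

    rowCondition-< : ∀ j → j < n → RowCondition (j + 0)
    rowCondition-< j j<n = begin
      ∑ n (λ i → D i r) + a r           ≡⟨ cong (_+ a r) (sym (∑-extend (λ i → D i r) j<n aboveZero)) ⟩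
      ∑ (suc j) (λ i → D i r) + a r     ≡⟨ cong (_+ a r) (∑-suc j _) ⟩
      ∑ j (λ i → D i r) + D j r + a r   ≡⟨ xy∙z≈xz∙y (∑ j (λ i → D i r)) (D j r) (a r) ⟩
      ∑ j (λ i → D i r) + a r + D j r   ≡⟨ cong₂ _+_ (partialSums j 0 (<⇒≤ j<n)) (shift-+ j _ 0) ⟩
      s j 0 + (m ∸ s j 0)               ≡⟨ m+[n∸m]≡n (s≤m j 0 (<⇒≤ j<n)) ⟩
      m                                 ≡⟨ sym (rowBase-< r (subst (_< n) (sym (+-identityʳ j)) j<n)) ⟩
      rowBase n β r                     ∎
      where
      open ≡-Reasoning
      r = j + 0
      aboveZero : ∀ i → suc j ≤ i → i < n → D i r ≡ 0
      aboveZero i j<i _ = shift-< i _ r (≤-<-trans (≤-reflexive (+-identityʳ j)) j<i)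

    rowCondition : ∀ r → RowCondition r
    rowCondition r with r <? n
    ... | yes r<n = subst RowCondition (+-identityʳ r) (rowCondition-< r r<n)
    ... | no  r≮n = subst RowCondition (m+[n∸m]≡n (≮⇒≥ r≮n))
                      (trans (partialSums n (r ∸ n) ≤-refl) (trans (s-n (r ∸ n)) (sym (rowBase-+ (r ∸ n)))))

    G : ℕ → ℕ → ℕ
    G j = sorted (D j) N

    G<N : ∀ {j p} → j < n → p < m → G j p < N
    G<N {j} {p} j<n p<m = sorted<R (D j) N m (∑D j j<n) p p<m

    c : Fin n → Fin m → Fin N
    c x y = fromℕ< (G<N (toℕ<n x) (toℕ<n y))

    toℕ-c : ∀ x y → toℕ (c x y) ≡ G (toℕ x) (toℕ y)
    toℕ-c x y = toℕ-fromℕ< (G<N (toℕ<n x) (toℕ<n y))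

    chosenRow-c : ∀ j p → j < n → p < m → chosenRow c j p ≡ G j p
    chosenRow-c j p j<n p<m = trans (chosenRow-< c j<n p<m)
      (trans (toℕ-c (fromℕ< j<n) (fromℕ< p<m)) (cong₂ G (toℕ-fromℕ< j<n) (toℕ-fromℕ< p<m)))

    count-c : ∀ j r → j < n → count m (chosenRow c j) r ≡ D j r
    count-c j r j<n = byCases (r <? N)
      where
      byCases : Dec (r < N) → count m (chosenRow c j) r ≡ D j r
      byCases (yes r<N) = trans (∑-cong m (λ p p<m → cong (λ v → ⟦ v ≟ r ⟧) (chosenRow-c j p j<n p<m)))
                                (count-sorted (D j) N m (∑D j j<n) r r<N)
      byCases (no r≮N) = trans (count≡0 m (chosenRow c j) r λ p p<m row≡r →
                                  r≮N (subst (_< N) (trans (sym (chosenRow-< c j<n p<m)) row≡r) (toℕ<n _)))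
                               (sym (D-≥N j r j<n (≮⇒≥ r≮N)))

    choice : Choice m b n α β
    choice = record
      { c      = c
      ; ones   = λ x y → subst (toℕ x ≤_) (sym (toℕ-c x y))
                   (sorted-≥ (D (toℕ x)) N m (∑D (toℕ x) (toℕ<n x)) (toℕ x)
                      (λ r r<j → shift-< (toℕ x) _ r r<j) (toℕ y) (toℕ<n y))
      ; rows   = λ r → trans
                   (cong (_+ a (toℕ r)) (trans (rowCount≡∑count c r)
                      (∑-cong n (λ j j<n → count-c j (toℕ r) j<n))))
                   (rowCondition (toℕ r))
      ; weakly = λ x p q p≤q → subst₂ _≤_ (sym (toℕ-c x p)) (sym (toℕ-c x q))
                   (sorted-weaklyIncreasing (D (toℕ x)) N m (∑D (toℕ x) (toℕ<n x))
                      (toℕ p) (toℕ q) p≤q (toℕ<n q))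
      }

  toChoice : Walk m b n α β → Choice m b n α β
  toChoice = FromWalk.choice

  toWalk : Choice m b n α β → Walk m b n α β
  toWalk = FromChoice.walk

  chosenRow-weaklyIncreasing : ∀ (ch : Choice m b n α β) j → j < n →
                               WeaklyIncreasing m (chosenRow (Choice.c ch) j)
  chosenRow-weaklyIncreasing ch j j<n p q p≤q q<m =
    subst₂ _≤_ (sym (chosenRow-< c j<n p<m)) (sym (chosenRow-< c j<n q<m))
      (weakly (fromℕ< j<n) (fromℕ< p<m) (fromℕ< q<m)
        (subst₂ _≤_ (sym (toℕ-fromℕ< p<m)) (sym (toℕ-fromℕ< q<m)) p≤q))
    where
    open Choice ch
    p<m = ≤-<-trans p≤q q<m

  toChoice-unique : ∀ w (ch : Choice m b n α β) →
                    (∀ j r → j < n → count m (chosenRow (Choice.c ch) j) r ≡ FromWalk.D w j r) →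
                    ∀ x y → Choice.c (toChoice w) x y ≡ Choice.c ch x y
  toChoice-unique w ch sameCounts x y = toℕ-injective (begin
    toℕ (W.c x y)                   ≡⟨ W.toℕ-c x y ⟩
    W.G j p                         ≡⟨ sym (sorted-unique (W.D j) N m (W.∑D j j<n) (chosenRow c j)
                                          (chosenRow-weaklyIncreasing ch j j<n) (λ _ p<m → C.G<N j<n p<m)
                                          (λ r _ → sameCounts j r j<n) p (toℕ<n y)) ⟩
    chosenRow c j p                 ≡⟨ chosenRow-toℕ c x y ⟩
    toℕ (c x y)                     ∎)
    where
    open ≡-Reasoning
    open Choice ch
    module W = FromWalk w
    module C = FromChoice ch
    j = toℕ x
    p = toℕ y
    j<n = toℕ<n x

  toChoice-cong : ∀ w w′ → (∀ i → proj₁ (Walk.σ w i) ≡ proj₁ (Walk.σ w′ i)) →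
                  ∀ x y → Choice.c (toChoice w) x y ≡ Choice.c (toChoice w′) x y
  toChoice-cong w w′ sameStates = toChoice-unique w (toChoice w′) λ j r j<n →
    trans (W′.count-c j r j<n) (sym (shift-cong j (gaps-cong (sameS j) (sameS (suc j))) r))
    where
    module W = FromWalk w
    module W′ = FromWalk w′
    sameS : ∀ j k → W.s j k ≡ W′.s j k
    sameS j k = extend-cong 0 (λ i → cong (_! k) (sameStates i)) j

  toWalk-cong : ∀ ch ch′ → (∀ x y → Choice.c ch x y ≡ Choice.c ch′ x y) →
                ∀ i → proj₁ (Walk.σ (toWalk ch) i) ≡ proj₁ (Walk.σ (toWalk ch′) i)
  toWalk-cong ch ch′ sameChoice i = state-ext (C.state i) (C′.state i) λ k → begin
    entry (C.state i) k       ≡⟨ C.entry-state i k ⟩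
    C.s (toℕ i) k             ≡⟨ cong (a (toℕ i + k) +_) (∑-cong (toℕ i) (λ j _ → sameD j (toℕ i + k))) ⟩
    C′.s (toℕ i) k            ≡⟨ sym (C′.entry-state i k) ⟩
    entry (C′.state i) k      ∎
    where
    open ≡-Reasoning
    module C = FromChoice ch
    module C′ = FromChoice ch′
    sameD : ∀ j r → C.D j r ≡ C′.D j r
    sameD j r = ∑-cong m (λ p _ → cong (λ v → ⟦ v ≟ r ⟧) (chosenRow-cong sameChoice j p))

  toChoice∘toWalk : ∀ ch x y → Choice.c (toChoice (toWalk ch)) x y ≡ Choice.c ch x y
  toChoice∘toWalk ch = toChoice-unique (toWalk ch) ch λ j r j<n →
    shift-unique j (C.D j) _ (λ r r<j → C.D-< j r j<n r<j) (sameGaps j j<n) r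
    where
    module C = FromChoice ch
    module W = FromWalk (toWalk ch)
    sameS : ∀ j k → j ≤ n → W.s j k ≡ C.s j k
    sameS j k j≤n = trans (W.s-≤n j k j≤n)
      (trans (C.entry-state (fromℕ< (s≤s j≤n)) k) (cong (λ v → C.s v k) (toℕ-fromℕ< (s≤s j≤n))))
    sameGaps : ∀ j → j < n → ∀ k → C.D j (j + k) ≡ gaps (W.s j) (W.s (suc j)) k
    sameGaps j j<n zero = sym (begin
      m ∸ W.s j 0                      ≡⟨ cong (m ∸_) (sameS j 0 (<⇒≤ j<n)) ⟩
      m ∸ C.s j 0                      ≡⟨ cong (_∸ C.s j 0) (sym (C.s+D≡m j j<n)) ⟩
      C.s j 0 + C.D j (j + 0) ∸ C.s j 0 ≡⟨ m+n∸m≡n (C.s j 0) _ ⟩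
      C.D j (j + 0)                    ∎)
      where open ≡-Reasoning
    sameGaps j j<n (suc k) = sym (begin
      W.s (suc j) k ∸ W.s j (suc k)                    ≡⟨ cong₂ _∸_ (sameS (suc j) k j<n) (sameS j (suc k) (<⇒≤ j<n)) ⟩
      C.s (suc j) k ∸ C.s j (suc k)                    ≡⟨ cong (_∸ C.s j (suc k)) (C.s-suc j k) ⟩
      C.s j (suc k) + C.D j (j + suc k) ∸ C.s j (suc k) ≡⟨ m+n∸m≡n (C.s j (suc k)) _ ⟩
      C.D j (j + suc k)                                ∎)
      where open ≡-Reasoning

  toWalk∘toChoice : ∀ w i → proj₁ (Walk.σ (toWalk (toChoice w)) i) ≡ proj₁ (Walk.σ w i)
  toWalk∘toChoice w i = state-ext (C.state i) (Walk.σ w i) λ k → begin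
    entry (C.state i) k                          ≡⟨ C.entry-state i k ⟩
    a (t + k) + C.P t (t + k)                    ≡⟨ +-comm (a (t + k)) _ ⟩
    C.P t (t + k) + a (t + k)                    ≡⟨ cong (_+ a (t + k)) (∑-cong t (λ j j<t →
                                                      W.count-c j (t + k) (<-≤-trans j<t t≤n))) ⟩
    ∑ t (λ j → W.D j (t + k)) + a (t + k)        ≡⟨ W.partialSums t k t≤n ⟩
    W.s t k                                      ≡⟨ W.s-toℕ i k ⟩
    entry (Walk.σ w i) k                         ∎
    where
    open ≡-Reasoning
    module W = FromWalk w
    module C = FromChoice (toChoice w)
    t = toℕ i
    t≤n = toℕ≤pred[n] i

lemma1 : (m b n : ℕ) → 1 ≤ m → 1 ≤ n → (α β : State m b) →
         Inverse (WalkSetoid m b n α β) (ChoiceSetoid m b n α β)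
lemma1 m b n _ _ α β = record
  { to        = toChoice
  ; from      = toWalk
  ; to-cong   = λ {w} {w′} → toChoice-cong w w′
  ; from-cong = λ {ch} {ch′} → toWalk-cong ch ch′
  ; inverse   = (λ {ch} {w} w≈ x y → trans (toChoice-cong w (toWalk ch) w≈ x y) (toChoice∘toWalk ch x y))
              , (λ {w} {ch} ch≈ i → trans (toWalk-cong ch (toChoice w) ch≈ i) (toWalk∘toChoice w i))
  }
  where open Correspondence m b n α β
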